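{- Let $(H=(V,E),\succ)$ be a hypergraphic preference system with $V=[n]$, and run Scarf's algorithm (with any cardinal pivoting rule) on its augmented block-partitioned instance $(A',b',C')$. Let $(B,O)\to(B',O)\to(B',O')$ be an iteration starting from a Scarf pair $(B,O)$. Let $j_\ell$, $j_r$, $j^*$ be the leaving column, the reference column and the entering column of the ordinal pivot $O\to O'$. Suppose $i$ is the separator of $(B,O)$ and $j_\ell$ is $i$-disliked with respect to $O$. Then: (i) $j_r=j^{\rightarrow}$ is the column of $O$ with the largest index; (ii) $j_r$ is $0$-disliked with respect to $O$, and $j^*$ is $0$-disliked with respect to $O'$; (iii) if $(B',O')$ is a Scarf pair (i.e. $B'\neq O'$), then its separator is some $i'>i$.
   Context: In a hypergraphic preference system $(H=(V,E),\succ)$, each $\succ_i$ is a strict order on $\delta(i)=\{e\in E:i\in e\}$. Each singleton $e_i=\{i\}$ is in $E$ and is least preferred. Block-partitioned matrices. For $i\in[n]$ let $S_i=\{e\in E\setminus\{e_i\}:\max e=i\}$. The columns are $e_1,\dots,e_n$ (columns $1..n$), then $S_1,\dots,S_n$, each in decreasing $\succ_i$-preference. $A$ is the incidence matrix. $C$ has entries $c_{i,j}=|\delta(i)|-\ell$ when $i\in e_j$ is $\ell$-th best in $\succ_i$; the other entries of row $i$ are distinct integers $\ge|\delta(i)|$ decreasing left to right. $b=\mathbf{1}$. Augmented instance: $A'=\begin{pmatrix}1&0^T\\0&A\end{pmatrix}$, $b'=(1,b^T)^T$, $C'=\begin{pmatrix}0&\xi^T\\ \chi&C\end{pmatrix}$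 with $\xi=(m,\dots,1)^T$ and $\chi=(M,\dots,M)^T$, $M>\max c_{i,j}$. Rows are indexed $0..n$, columns $0..m$. Scarf's algorithm: - Utility: $u^O_i=\min_{j\in O}c'_{i,j}$. Column $j\in O$ is $i$-disliked if $u^O_i=c'_{i,j}$. - Cardinal pivot from a feasible basis $B$ with entering $j_t$: $y=(A'_B)^{ -1}A'_{j_t}$, and the leaving column minimizes $x_j/y_j$ over $j\in B$ with $y_j>0$, chosen by a pivoting rule. - Ordinal pivot from ordinal basis $O$ with leaving $j_\ell$: let $i_\ell$ be the row disliking $j_\ell$. The reference column is $j_r=\arg\min_{j\in O\setminus\{j_\ell\}}c'_{i_\ell,j}$, and the reference row $i_r$ is the row disliking $j_r$. The entering column is $j^*=\arg\max\{c'_{i_r,k}:k\notin O,\ c'_{i,k}>u^{O\setminus\{j_\ell\}}_i\ \forall i\ne i_r\}$, and $O'=O\setminus\{j_\ell\}\cup\{j^*\}$. - Start from $B_0=\{0,\dots,n\}$, $O_0=\{1,\dots,n+1\}$. An iteration $(B_k,O_k)\to(B_{k+1},O_k)\to(B_{k+1},O_{k+1})$ is a cardinal pivot (entering $O_k\setminus B_k$) followed by an ordinal pivot (leaving $O_k\setminus B_{k+1}$). Stop when the bases coincide. - A Scarf pair is a pair $(B_k,O_k)$ with $B_k\ne O_k$. Separator: for a Scarf pair $(B,O)$, let $j^{\rightarrow}$ be the $0$-disliked column with respect to $O$ (the largest-index column of $O$). If $j^{\rightarrow}\in S_i$, then $i$ is the separator of $(B,O)$. -}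

module Defs where

open import Data.Nat using (ℕ; zero; suc) renaming (_≤_ to _≤ℕ_; _<_ to _<ℕ_; _∸_ to _∸ℕ_)
open import Data.Fin using (Fin; zero; suc; toℕ; _≤_; _<_)
open import Data.Fin.Subset using (Subset; Side; inside; outside; ⁅_⁆; Nonempty; ∣_∣)
  renaming (_∈_ to _∈ˢ_; _∉_ to _∉ˢ_)
open import Data.Vec using (Vec; tabulate; lookup; _[_]≔_)
open import Data.List using (List; length)
open import Data.List.Membership.Propositional using () renaming (_∈_ to _∈ˡ_)
open import Data.List.Relation.Unary.Any using (index)
open import Data.List.Relation.Unary.Unique.Propositional using (Unique)
open import Data.Bool using (if_then_else_)
import Data.Bool
import Data.Nat
open import Data.Rational using (ℚ; 0ℚ; 1ℚ; _+_; _*_; _÷_; >-nonZero)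
  renaming (_≤_ to _≤ℚ_; _<_ to _<ℚ_)
open import Data.Product using (Σ; ∃; ∃-syntax; _×_; _,_)
open import Data.Sum using (_⊎_)
open import Data.Empty using (⊥)
open import Function.Bundles using (_⇔_)
open import Relation.Binary.PropositionalEquality using (_≡_; _≢_)
open import Relation.Binary.Construct.Closure.ReflexiveTransitive using (Star)

-- Conventions
--   * Vertices V = [n] are represented by Fin n (vertex v : Fin n stands
--     for the vertex toℕ v + 1).
--   * The columns of A (the hyperedges) are Fin m; edge k is the column
--     k+1 of A.  The enumeration of the edges is required to be the
--     block-partitioned column order (see `BlockOrdered`); that order is
--     uniquely determined by (H, ≻).
--   * Augmented rows are Fin (suc n) (row 0 = zero, row of vertex v = suc v),
--     augmented columns are Fin (suc m) (column 0 = zero, column of edge k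
--     = suc k).

IsMax : ∀ {n} → Subset n → Fin n → Set
IsMax S v = v ∈ˢ S × (∀ w → w ∈ˢ S → w ≤ v)

record HPS (n : ℕ) : Set where
  field
    m        : ℕ
    edge     : Fin m → Subset n
    -- E is a set of nonempty subsets of V
    edge-injective : ∀ k k' → edge k ≡ edge k' → k ≡ k'
    edge-nonempty  : ∀ k → Nonempty (edge k)
    singleton-edge : ∀ (v : Fin n) → ∃[ k ] edge k ≡ ⁅ v ⁆
    -- ≻_v : a strict (total) order on δ(v), given as the list of δ(v)
    -- from most preferred to least preferred
    pref          : Fin n → List (Fin m)
    pref-unique   : ∀ v → Unique (pref v)
    pref-complete : ∀ v k → (k ∈ˡ pref v) ⇔ (v ∈ˢ edge k)
    singleton-last : ∀ v k (p : k ∈ˡ pref v) → edge k ≡ ⁅ v ⁆ →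
                     suc (toℕ (index p)) ≡ length (pref v)

  δ : Fin n → Subset m
  δ v = tabulate (λ k → lookup (edge k) v)

  deg : Fin n → ℕ
  deg v = ∣ δ v ∣

  Prefers : Fin n → Fin m → Fin m → Set
  Prefers v k k' = Σ (k ∈ˡ pref v) λ p → Σ (k' ∈ˡ pref v) λ q → index p < index q

  InS : Fin n → Fin m → Set
  InS i k = edge k ≢ ⁅ i ⁆ × IsMax (edge k) i

  -- The block-partitioned column order: columns 1..n of A are e_1..e_n,
  -- then S_1,...,S_n, each in decreasing ≻_i-preference.
  record BlockOrdered : Set where
    field
      n≤m        : n ≤ℕ m
      singletons : ∀ (k : Fin m) (v : Fin n) → toℕ k ≡ toℕ v → edge k ≡ ⁅ v ⁆
      blocks     : ∀ (k k' : Fin m) (i i' : Fin n) → n ≤ℕ toℕ k → k < k' →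
                   IsMax (edge k) i → IsMax (edge k') i' →
                   i < i' ⊎ (i ≡ i' × Prefers i k k')

  record ValidCost (C : Fin n → Fin m → ℕ) : Set where
    field
      incident     : ∀ v k (p : k ∈ˡ pref v) → C v k ≡ deg v ∸ℕ suc (toℕ (index p))
      nonincident  : ∀ v k → k ∉ˢ δ v → deg v ≤ℕ C v k
      decreasing   : ∀ v k k' → k ∉ˢ δ v → k' ∉ˢ δ v → k < k' → C v k' <ℕ C v k

sumℚ : ∀ {k} → (Fin k → ℚ) → ℚ
sumℚ {zero}  f = 0ℚ
sumℚ {suc k} f = f zero + sumℚ (λ j → f (suc j))

remove : ∀ {k} → Subset k → Fin k → Subset k
remove S j = S [ j ]≔ outside

exchange : ∀ {k} → Subset k → Fin k → Fin k → Subset k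
exchange S out inn = remove S out [ inn ]≔ inside

module Scarf {n : ℕ} (H : HPS n) (C : Fin n → Fin (HPS.m H) → ℕ) (M : ℕ) where
  open HPS H

  Row Col : Set
  Row = Fin (suc n)
  Col = Fin (suc m)

  Cols : Set
  Cols = Subset (suc m)

  A' : Row → Col → ℚ
  A' zero    zero    = 1ℚ
  A' zero    (suc k) = 0ℚ
  A' (suc v) zero    = 0ℚ
  A' (suc v) (suc k) = if lookup (edge k) v then 1ℚ else 0ℚ

  b' : Row → ℚ
  b' _ = 1ℚ

  -- C' with ξ = (m, ..., 1) and χ = (M, ..., M)
  C' : Row → Col → ℕ
  C' zero    zero    = 0
  C' zero    (suc k) = m ∸ℕ toℕ k
  C' (suc v) zero    = M
  C' (suc v) (suc k) = C v k

  A'· : (Col → ℚ) → Row → ℚ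
  A'· z r = sumℚ (λ j → A' r j * z j)

  BasicSol : Cols → (Row → ℚ) → (Col → ℚ) → Set
  BasicSol B rhs z = (∀ j → j ∉ˢ B → z j ≡ 0ℚ) × (∀ r → A'· z r ≡ rhs r)

  -- Cardinal pivot from B with entering column jt and leaving column jl
  -- (jl is any minimiser of the ratio test: the pivoting rule is arbitrary).
  CardPivot : Cols → Col → Col → Cols → Set
  CardPivot B jt jl B' =
    Σ (Col → ℚ) λ x → Σ (Col → ℚ) λ y →
      BasicSol B b' x × BasicSol B (λ r → A' r jt) y ×
      jl ∈ˢ B ×
      Σ (0ℚ <ℚ y jl) λ yl>0 →
        (∀ j → j ∈ˢ B → (yj>0 : 0ℚ <ℚ y j) →
           (x jl ÷ y jl) {{>-nonZero yl>0}} ≤ℚ (x j ÷ y j) {{>-nonZero yj>0}}) ×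
      B' ≡ exchange B jl jt

  IsUtility : Cols → Row → ℕ → Set
  IsUtility S i u = (∃[ j ] (j ∈ˢ S × C' i j ≡ u)) × (∀ j → j ∈ˢ S → u ≤ℕ C' i j)

  Disliked : Cols → Row → Col → Set
  Disliked O i j = j ∈ˢ O × IsUtility O i (C' i j)

  record OrdPivot (O : Cols) (jl : Col) (il : Row) (jr : Col) (ir : Row)
                  (j* : Col) (O' : Cols) : Set where
    field
      jl∈O     : jl ∈ˢ O
      il-jl    : Disliked O il jl
      jr∈      : jr ∈ˢ remove O jl
      jr-min   : ∀ j → j ∈ˢ remove O jl → C' il jr ≤ℕ C' il j
      ir-jr    : Disliked O ir jr
      j*∉O     : j* ∉ˢ O
      j*-cand  : ∀ i → i ≢ ir → ∀ u → IsUtility (remove O jl) i u → u <ℕ C' i j*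
      j*-max   : ∀ k → k ∉ˢ O →
                 (∀ i → i ≢ ir → ∀ u → IsUtility (remove O jl) i u → u <ℕ C' i k) →
                 C' ir k ≤ℕ C' ir j*
      O'≡      : O' ≡ exchange O jl j*

  -- B_0 = {0,...,n},  O_0 = {1,...,n+1}
  B₀ O₀ : Cols
  B₀ = tabulate (λ j → Data.Nat._≤ᵇ_ (toℕ j) n)
  O₀ = tabulate (λ j → Data.Bool._∧_ (Data.Nat._≤ᵇ_ 1 (toℕ j)) (Data.Nat._≤ᵇ_ (toℕ j) (suc n)))

  State : Set
  State = Cols × Cols

  Iteration : State → State → Set
  Iteration (B , O) (B' , O') =
    B ≢ O ×
    Σ Col λ jt → jt ∈ˢ O × jt ∉ˢ B × Σ Col λ jl′ → CardPivot B jt jl′ B' ×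
    Σ Col λ jl → jl ∈ˢ O × jl ∉ˢ B' ×
    Σ Row λ il → Σ Col λ jr → Σ Row λ ir → Σ Col λ j* → OrdPivot O jl il jr ir j* O'

  Reachable : State → Set
  Reachable s = Star Iteration (B₀ , O₀) s

  InSᶜ : Fin n → Col → Set
  InSᶜ i zero    = ⊥
  InSᶜ i (suc k) = InS i k

  Separator : Cols → Cols → Fin n → Set
  Separator B O i = B ≢ O × ∃[ j ] (Disliked O zero j × InSᶜ i j)

-- Along every run, (B, O) satisfies Scarf's invariant: O is an ordinal basis whose columns are
-- disliked by pairwise distinct rows, 0 ∉ O, and B = {0} ∪ O ∖ {t} for a single column t ∈ O.
-- Let j→ ∈ S_i be the separator column (disliked by row 0) and let row i dislike j_ℓ. Within
-- O ∖ {j_ℓ}, row i finds j→ cheapest: non-incident columns cost more than incident ones, i's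
-- singleton would be what i dislikes, and the S-columns left of j→ lie in earlier blocks or are
-- preferred by i. So j_r = j→, row 0 is the reference row and j* becomes 0-disliked. Then j* lies
-- right of j→ although i ranks it below j→, which the block order only allows in a later block.
module Submission where

open import Data.Bool using (true; false)
open import Data.Bool.Properties using (T-≡)
open import Data.Empty using (⊥-elim)
open import Data.Fin using (Fin; zero; suc; toℕ; fromℕ<; _≤_; _<_)
import Data.Fin
import Data.Fin.Properties as Finₚ
open import Data.Fin.Subset using (Subset; Nonempty; ⁅_⁆; ∣_∣)
  renaming (_∈_ to _∈ˢ_; _∉_ to _∉ˢ_)
open import Data.Fin.Subset.Properties
  using (_∈?_; nonempty?; x∈⁅x⁆; x∈⁅y⁆⇒x≡y; ⊆-antisym; p⊂q⇒∣p∣<∣q∣)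
open import Data.List using (List; []; _∷_; length)
import Data.List
open import Data.List.Membership.Propositional using () renaming (_∈_ to _∈ˡ_)
import Data.List.Relation.Unary.All as All
open import Data.List.Relation.Unary.AllPairs using ([]; _∷_)
open import Data.List.Relation.Unary.Any using (here; there; index)
open import Data.List.Relation.Unary.Any.Properties using (lookup-index)
open import Data.List.Relation.Unary.Unique.Propositional using (Unique)
open import Data.Nat using (ℕ; zero; suc; z≤n; s≤s; s≤s⁻¹; _∸_)
  renaming (_≤_ to _≤ℕ_; _<_ to _<ℕ_)
import Data.Nat
import Data.Nat.Properties as ℕₚ
open import Data.Product using (∃-syntax; _×_; _,_; proj₁; proj₂; uncurry)
open import Data.Sum using (_⊎_; inj₁; inj₂; [_,_]′)
open import Data.Vec using (Vec; _∷_; []; here; there; lookup; tabulate; _[_]=_; _[_]≔_)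
open import Data.Vec.Properties
  using ([]=⇒lookup; lookup⇒[]=; []=-injective; []≔-updates; []≔-minimal; lookup∘updateAt′; lookup∘tabulate)
open import Function using (_∘_; id)
open import Function.Bundles using (Equivalence)
open import Relation.Binary using (tri<; tri≈; tri>)
open import Relation.Binary.Construct.Closure.ReflexiveTransitive using (Star; ε; _◅_)
open import Relation.Binary.PropositionalEquality
open import Relation.Nullary using (yes; no; Dec; contradiction; ¬?; _×-dec_)
open import Defs

[]≔-minimal⁻ : ∀ {A : Set} {k} (xs : Vec A k) {i j : Fin k} {x y : A} →
               i ≢ j → (xs [ j ]≔ y) [ i ]= x → xs [ i ]= x
[]≔-minimal⁻ xs {i} {j} i≢j p =
  lookup⇒[]= i xs (trans (sym (lookup∘updateAt′ i j i≢j xs)) ([]=⇒lookup p))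

module _ {k} {S : Subset k} {a : Fin k} where

  ∈-remove⁻ : ∀ {j} → j ∈ˢ remove S a → j ∈ˢ S × j ≢ a
  ∈-remove⁻ {j} p with j Finₚ.≟ a
  ... | yes refl = contradiction ([]=-injective p ([]≔-updates S a)) λ ()
  ... | no j≢a   = []≔-minimal⁻ S j≢a p , j≢a

  ∈-remove⁺ : ∀ {j} → j ∈ˢ S → j ≢ a → j ∈ˢ remove S a
  ∈-remove⁺ {j} p j≢a = []≔-minimal S j a j≢a p

  module _ {b : Fin k} where

    ∈-exchange⁻ : ∀ {j} → j ∈ˢ exchange S a b → j ≡ b ⊎ (j ∈ˢ S × j ≢ a)
    ∈-exchange⁻ {j} p with j Finₚ.≟ b
    ... | yes j≡b = inj₁ j≡b
    ... | no j≢b  = inj₂ (∈-remove⁻ ([]≔-minimal⁻ (remove S a) j≢b p))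

    ∈-exchange-new : b ∈ˢ exchange S a b
    ∈-exchange-new = []≔-updates (remove S a) b

    ∈-exchange⁺ : ∀ {j} → j ∈ˢ S → j ≢ a → j ∈ˢ exchange S a b
    ∈-exchange⁺ {j} p j≢a with j Finₚ.≟ b
    ... | yes refl = ∈-exchange-new
    ... | no j≢b   = []≔-minimal (remove S a) j b j≢b (∈-remove⁺ p j≢a)

module _ {k} (f : Fin k → Data.Bool.Bool) {j : Fin k} where

  ∈-tabulate⁻ : j ∈ˢ tabulate f → f j ≡ true
  ∈-tabulate⁻ p = trans (sym (lookup∘tabulate f j)) ([]=⇒lookup p)

  ∈-tabulate⁺ : f j ≡ true → j ∈ˢ tabulate f
  ∈-tabulate⁺ e = lookup⇒[]= j (tabulate f) (trans (lookup∘tabulate f j) e)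

minimiser : ∀ {k} (S : Subset k) (f : Fin k → ℕ) → Nonempty S →
            ∃[ j ] (j ∈ˢ S × (∀ j' → j' ∈ˢ S → f j ≤ℕ f j'))
minimiser (s ∷ S) f ne with nonempty? S
minimiser (s ∷ S) f (zero , here) | no S-empty =
  zero , here , λ { zero _ → ℕₚ.≤-refl ; (suc j) (there p) → contradiction (j , p) S-empty }
minimiser (s ∷ S) f (suc j , there p) | no S-empty = contradiction (j , p) S-empty
minimiser (s ∷ S) f ne | yes S-ne with minimiser S (f ∘ suc) S-ne
minimiser (false ∷ S) f ne | yes _ | j , p , min =
  suc j , there p , λ { zero () ; (suc j') (there q) → min j' q }
minimiser (true ∷ S) f ne | yes _ | j , p , min with ℕₚ.≤-total (f zero) (f (suc j))
... | inj₁ f₀≤ =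
  zero , here , λ { zero _ → ℕₚ.≤-refl ; (suc j') (there q) → ℕₚ.≤-trans f₀≤ (min j' q) }
... | inj₂ ≤f₀ = suc j , there p , λ { zero _ → ≤f₀ ; (suc j') (there q) → min j' q }

largest : ∀ {k} (S : Subset k) → Nonempty S → ∃[ v ] IsMax S v
largest {k} S ne with minimiser S (λ j → k ∸ toℕ j) ne
... | v , v∈S , min = v , v∈S , λ w w∈S → ℕₚ.∸-cancelʳ-≤ (ℕₚ.<⇒≤ (Finₚ.toℕ<n w)) (min w w∈S)

unique-length≤∣∣ : ∀ {k} {S : Subset k} {xs : List (Fin k)} → Unique xs →
                   (∀ {x} → x ∈ˡ xs → x ∈ˢ S) → length xs ≤ℕ ∣ S ∣
unique-length≤∣∣ {xs = []} _ _ = z≤n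
unique-length≤∣∣ {S = S} {x ∷ xs} (x∉xs ∷ uniq) xs⊆S =
  ℕₚ.≤-trans (s≤s (unique-length≤∣∣ uniq xs⊆S∖x))
             (p⊂q⇒∣p∣<∣q∣ (proj₁ ∘ ∈-remove⁻ , x , xs⊆S (here refl) , x∉S∖x))
  where
    x∉S∖x : x ∉ˢ remove S x
    x∉S∖x x∈ = proj₂ (∈-remove⁻ x∈) refl
    xs⊆S∖x : ∀ {y} → y ∈ˡ xs → y ∈ˢ remove S x
    xs⊆S∖x y∈xs = ∈-remove⁺ (xs⊆S (there y∈xs)) λ y≡x → All.lookup x∉xs y∈xs (sym y≡x)

module CostFacts {n} (H : HPS n) {C : Fin n → Fin (HPS.m H) → ℕ} (VC : HPS.ValidCost H C) where
  open HPS H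
  open ValidCost VC

  ∈δ⇒∈edge : ∀ {v k} → k ∈ˢ δ v → v ∈ˢ edge k
  ∈δ⇒∈edge {v} {k} p = lookup⇒[]= v (edge k) (∈-tabulate⁻ (λ k → lookup (edge k) v) p)

  ∈edge⇒∈δ : ∀ {v k} → v ∈ˢ edge k → k ∈ˢ δ v
  ∈edge⇒∈δ {v} p = ∈-tabulate⁺ (λ k → lookup (edge k) v) ([]=⇒lookup p)

  ∈edge⇒∈pref : ∀ {v k} → v ∈ˢ edge k → k ∈ˡ pref v
  ∈edge⇒∈pref {v} {k} = Equivalence.from (pref-complete v k)

  ∈pref⇒∈edge : ∀ {v k} → k ∈ˡ pref v → v ∈ˢ edge k
  ∈pref⇒∈edge {v} {k} = Equivalence.to (pref-complete v k)

  singleton∋ : ∀ {v k} → edge k ≡ ⁅ v ⁆ → v ∈ˢ edge k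
  singleton∋ {v} e = subst (v ∈ˢ_) (sym e) (x∈⁅x⁆ v)

  rank<deg : ∀ {v k} (p : k ∈ˡ pref v) → suc (toℕ (index p)) ≤ℕ deg v
  rank<deg {v} p =
    ℕₚ.≤-trans (Finₚ.toℕ<n (index p)) (unique-length≤∣∣ (pref-unique v) (∈edge⇒∈δ ∘ ∈pref⇒∈edge))

  incident-cost<deg : ∀ {v k} → v ∈ˢ edge k → C v k <ℕ deg v
  incident-cost<deg {v} {k} v∈e =
    subst (_<ℕ deg v) (sym (incident v k p))
          (ℕₚ.∸-monoʳ-< {deg v} {suc (toℕ (index p))} {0} (s≤s z≤n) (rank<deg p))
    where p = ∈edge⇒∈pref v∈e

  ∉edge⇒∉δ : ∀ {v k} → v ∉ˢ edge k → k ∉ˢ δ v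
  ∉edge⇒∉δ v∉e = v∉e ∘ ∈δ⇒∈edge

  deg≤nonincident-cost : ∀ {v k} → v ∉ˢ edge k → deg v ≤ℕ C v k
  deg≤nonincident-cost {v} {k} v∉e = nonincident v k (∉edge⇒∉δ v∉e)

  incident<nonincident : ∀ {v k k'} → v ∈ˢ edge k → v ∉ˢ edge k' → C v k <ℕ C v k'
  incident<nonincident v∈e v∉e' = ℕₚ.<-≤-trans (incident-cost<deg v∈e) (deg≤nonincident-cost v∉e')

  incident-cost-injective : ∀ {v k k'} (p : k ∈ˡ pref v) (q : k' ∈ˡ pref v) → C v k ≡ C v k' → k ≡ k'
  incident-cost-injective {v} {k} {k'} p q eq = begin
    k                                ≡⟨ lookup-index p ⟩
    Data.List.lookup (pref v) (index p) ≡⟨ cong (Data.List.lookup (pref v)) same-rank ⟩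
    Data.List.lookup (pref v) (index q) ≡⟨ lookup-index q ⟨
    k'                               ∎
    where
      open ≡-Reasoning
      same-rank : index p ≡ index q
      same-rank = Finₚ.toℕ-injective (ℕₚ.suc-injective (ℕₚ.∸-cancelˡ-≡ (rank<deg p) (rank<deg q)
                    (trans (sym (incident v k p)) (trans eq (incident v k' q)))))

  cost-injective : ∀ v {k k'} → C v k ≡ C v k' → k ≡ k'
  cost-injective v {k} {k'} eq with v ∈? edge k | v ∈? edge k'
  ... | yes v∈e | yes v∈e' = incident-cost-injective (∈edge⇒∈pref v∈e) (∈edge⇒∈pref v∈e') eq
  ... | yes v∈e | no v∉e'  = contradiction eq (ℕₚ.<⇒≢ (incident<nonincident v∈e v∉e'))
  ... | no v∉e  | yes v∈e' = contradiction (sym eq) (ℕₚ.<⇒≢ (incident<nonincident v∈e' v∉e))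
  ... | no v∉e  | no v∉e'  with Finₚ.<-cmp k k'
  ...   | tri< k<k' _ _ = contradiction (sym eq) (ℕₚ.<⇒≢ (decreasing v k k' (∉edge⇒∉δ v∉e) (∉edge⇒∉δ v∉e') k<k'))
  ...   | tri≈ _ k≡k' _ = k≡k'
  ...   | tri> _ _ k'<k = contradiction eq (ℕₚ.<⇒≢ (decreasing v k' k (∉edge⇒∉δ v∉e') (∉edge⇒∉δ v∉e) k'<k))

  Prefers⇒cost> : ∀ {v k k'} → Prefers v k k' → C v k' <ℕ C v k
  Prefers⇒cost> {v} {k} {k'} (p , q , p<q) =
    subst₂ _<ℕ_ (sym (incident v k' q)) (sym (incident v k p)) (ℕₚ.∸-monoʳ-< (s≤s p<q) (rank<deg q))

  -- the singleton of v is ranked last, so it has the least incident cost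
  singleton-cost-least : ∀ {v k k'} → edge k ≡ ⁅ v ⁆ → k' ≢ k → C v k <ℕ C v k'
  singleton-cost-least {v} {k} {k'} e k'≢k with v ∈? edge k'
  ... | no v∉e' = incident<nonincident (singleton∋ e) v∉e'
  ... | yes v∈e' = ℕₚ.≤∧≢⇒< (subst₂ _≤ℕ_ (sym (incident v k p)) (sym (incident v k' q)) ranks)
                            (k'≢k ∘ sym ∘ cost-injective v)
    where
      p = ∈edge⇒∈pref (singleton∋ e)
      q = ∈edge⇒∈pref v∈e'
      ranks : deg v ∸ suc (toℕ (index p)) ≤ℕ deg v ∸ suc (toℕ (index q))
      ranks = ℕₚ.∸-monoʳ-≤ (deg v)
                (subst (suc (toℕ (index q)) ≤ℕ_) (sym (singleton-last v k p e)) (Finₚ.toℕ<n (index q)))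

module BlockFacts {n} (H : HPS n) (BO : HPS.BlockOrdered H)
                  {C : Fin n → Fin (HPS.m H) → ℕ} (VC : HPS.ValidCost H C) where
  open HPS H
  open BlockOrdered BO
  open CostFacts H VC

  singletonColumn : Fin n → Fin m
  singletonColumn v = fromℕ< (ℕₚ.<-≤-trans (Finₚ.toℕ<n v) n≤m)

  toℕ-singletonColumn : ∀ v → toℕ (singletonColumn v) ≡ toℕ v
  toℕ-singletonColumn v = Finₚ.toℕ-fromℕ< _

  edge-singletonColumn : ∀ v → edge (singletonColumn v) ≡ ⁅ v ⁆
  edge-singletonColumn v = singletons _ v (toℕ-singletonColumn v)

  singleton-index : ∀ {k v} → edge k ≡ ⁅ v ⁆ → toℕ k ≡ toℕ v
  singleton-index {k} {v} e =
    trans (cong toℕ (edge-injective k _ (trans e (sym (edge-singletonColumn v))))) (toℕ-singletonColumn v)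

  low-column-singleton : ∀ {k v} → toℕ k <ℕ n → v ∈ˢ edge k → edge k ≡ ⁅ v ⁆
  low-column-singleton {k} {v} k<n v∈e = trans e (cong ⁅_⁆ (sym (x∈⁅y⁆⇒x≡y _ (subst (v ∈ˢ_) e v∈e))))
    where e = singletons k (fromℕ< k<n) (sym (Finₚ.toℕ-fromℕ< k<n))

  S-column-index : ∀ {i k} → InS i k → n ≤ℕ toℕ k
  S-column-index (e≢ , i∈e , _) = ℕₚ.≮⇒≥ λ k<n → e≢ (low-column-singleton k<n i∈e)

  earlier-column-costlier : ∀ {i k k'} → InS i k → n ≤ℕ toℕ k' → k' < k → i ∈ˢ edge k' → C i k <ℕ C i k'
  earlier-column-costlier {i} {k} {k'} (_ , i-max) n≤k' k'<k i∈e' with largest (edge k') (i , i∈e')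
  ... | i' , i'-max with blocks k' k i' i n≤k' k'<k i'-max i-max
  ...   | inj₁ i'<i = contradiction (proj₂ i'-max i i∈e') (ℕₚ.<⇒≱ i'<i)
  ...   | inj₂ (refl , pref) = Prefers⇒cost> pref

  later-column : ∀ {i k k* i'} → InS i k → k < k* → IsMax (edge k*) i' → i < i' ⊎ C i k* <ℕ C i k
  later-column k∈Sᵢ@(_ , i-max) k<k* i'-max with blocks _ _ _ _ (S-column-index k∈Sᵢ) k<k* i-max i'-max
  ... | inj₁ i<i' = inj₁ i<i'
  ... | inj₂ (refl , pref) = inj₂ (Prefers⇒cost> pref)

module AugmentedCosts {n} (H : HPS n) {C : Fin n → Fin (HPS.m H) → ℕ} (VC : HPS.ValidCost H C)
                      {M : ℕ} (C<M : ∀ v k → C v k <ℕ M) where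
  open HPS H
  open CostFacts H VC
  open Scarf H C M

  row₀-cost-positive : ∀ (k : Fin m) → 0 <ℕ m ∸ toℕ k
  row₀-cost-positive k = ℕₚ.m<n⇒0<n∸m (Finₚ.toℕ<n k)

  C'-injective : ∀ r {j j'} → C' r j ≡ C' r j' → j ≡ j'
  C'-injective zero    {zero}  {zero}   _ = refl
  C'-injective zero    {zero}  {suc k'} e = contradiction e (ℕₚ.<⇒≢ (row₀-cost-positive k'))
  C'-injective zero    {suc k} {zero}   e = contradiction (sym e) (ℕₚ.<⇒≢ (row₀-cost-positive k))
  C'-injective zero    {suc k} {suc k'} e = cong suc (Finₚ.toℕ-injective
    (ℕₚ.∸-cancelˡ-≡ (ℕₚ.<⇒≤ (Finₚ.toℕ<n k)) (ℕₚ.<⇒≤ (Finₚ.toℕ<n k')) e))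
  C'-injective (suc v) {zero}  {zero}   _ = refl
  C'-injective (suc v) {zero}  {suc k'} e = contradiction (sym e) (ℕₚ.<⇒≢ (C<M v k'))
  C'-injective (suc v) {suc k} {zero}   e = contradiction e (ℕₚ.<⇒≢ (C<M v k))
  C'-injective (suc v) {suc k} {suc k'} e = cong suc (cost-injective v e)

  row₀-antitone : ∀ {k k'} → C' zero (suc k) ≤ℕ C' zero (suc k') → toℕ k' ≤ℕ toℕ k
  row₀-antitone {k' = k'} = ℕₚ.∸-cancelʳ-≤ (ℕₚ.<⇒≤ (Finₚ.toℕ<n k'))

  row₀-strictly-antitone : ∀ {k k'} → toℕ k <ℕ toℕ k' → C' zero (suc k') <ℕ C' zero (suc k)
  row₀-strictly-antitone {k' = k'} k<k' = ℕₚ.∸-monoʳ-< k<k' (ℕₚ.<⇒≤ (Finₚ.toℕ<n k'))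

  row₀-disliked-largest : ∀ {O k j} → Disliked O zero (suc k) → j ∈ˢ O → j ≤ suc k
  row₀-disliked-largest {j = zero}   _             _   = z≤n
  row₀-disliked-largest {j = suc k'} (_ , _ , min) j∈O = s≤s (row₀-antitone (min (suc k') j∈O))

  singleton-cheapest : ∀ {v k} → edge k ≡ ⁅ v ⁆ → ∀ j → j ≢ zero → C' (suc v) j ≤ℕ C v k → j ≡ suc k
  singleton-cheapest e zero     j≢0 _ = contradiction refl j≢0
  singleton-cheapest {k = k} e (suc k') _   c≤ with k' Finₚ.≟ k
  ... | yes refl  = refl
  ... | no  k'≢k = contradiction c≤ (ℕₚ.<⇒≱ (singleton-cost-least e k'≢k))

  utility-exists : ∀ (S : Cols) r → Nonempty S → ∃[ j ] (j ∈ˢ S × IsUtility S r (C' r j))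
  utility-exists S r ne with minimiser S (C' r) ne
  ... | j , j∈S , min = j , j∈S , (j , j∈S , refl) , min

  utility-unique : ∀ {S} r {u u'} → IsUtility S r u → IsUtility S r u' → u ≡ u'
  utility-unique r ((j , j∈S , refl) , min) ((j' , j'∈S , refl) , min') =
    ℕₚ.≤-antisym (min j' j'∈S) (min' j j∈S)

  disliked-column-unique : ∀ {S} r {j j'} → Disliked S r j → Disliked S r j' → j ≡ j'
  disliked-column-unique r (_ , U) (_ , U') = C'-injective r (utility-unique r U U')

  below-utility : ∀ {S} r {u c} → IsUtility S r u → c ≤ℕ u → ∀ j → j ∈ˢ S → c ≤ℕ C' r j
  below-utility _ (_ , min) c≤u j j∈S = ℕₚ.≤-trans c≤u (min j j∈S)

module ScarfPairs {n} (H : HPS n) (C : Fin n → Fin (HPS.m H) → ℕ) (M : ℕ) where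
  open Scarf H C M

  record OrdinalBasis (O : Cols) : Set where
    field
      outside-dominated : ∀ k → k ∉ˢ O → ∃[ r ] (∀ j → j ∈ˢ O → C' r k ≤ℕ C' r j)
      disliker-unique   : ∀ {r r' j} → Disliked O r j → Disliked O r' j → r ≡ r'

  record Shape (B O : Cols) (t : Col) : Set where
    field
      shape⁻ : ∀ {j} → j ∈ˢ B → j ≡ zero ⊎ (j ∈ˢ O × j ≢ t)
      shape⁺ : ∀ {j} → j ≡ zero ⊎ (j ∈ˢ O × j ≢ t) → j ∈ˢ B

  record ScarfInvariant (B O : Cols) : Set where
    field
      ordinal    : OrdinalBasis O
      zero∉O     : zero ∉ˢ O
      outsider   : Col
      outsider∈O : outsider ∈ˢ O
      shape      : Shape B O outsider

  shape-zero⇒≡ : ∀ {B O} → Shape B O zero → zero ∈ˢ O → B ≡ O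
  shape-zero⇒≡ {B} {O} s 0∈O = ⊆-antisym B⊆O O⊆B
    where
      open Shape s
      B⊆O : ∀ {j} → j ∈ˢ B → j ∈ˢ O
      B⊆O j∈B = [ (λ { refl → 0∈O }) , proj₁ ]′ (shape⁻ j∈B)
      O⊆B : ∀ {j} → j ∈ˢ O → j ∈ˢ B
      O⊆B {j} j∈O with j Finₚ.≟ zero
      ... | yes j≡0 = shape⁺ (inj₁ j≡0)
      ... | no  j≢0 = shape⁺ (inj₂ (j∈O , j≢0))

  module _ {O jl il jr ir j* O'} (op : OrdPivot O jl il jr ir j* O') where
    open OrdPivot op

    ∈O'⁻ : ∀ {j} → j ∈ˢ O' → j ≡ j* ⊎ (j ∈ˢ O × j ≢ jl)
    ∈O'⁻ {j} p = ∈-exchange⁻ (subst (j ∈ˢ_) O'≡ p)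

    ∈O'⁺ : ∀ {j} → j ∈ˢ O → j ≢ jl → j ∈ˢ O'
    ∈O'⁺ {j} p j≢jl = subst (j ∈ˢ_) (sym O'≡) (∈-exchange⁺ p j≢jl)

    j*∈O' : j* ∈ˢ O'
    j*∈O' = subst (j* ∈ˢ_) (sym O'≡) ∈-exchange-new

    jr∈O : jr ∈ˢ O
    jr∈O = proj₁ (∈-remove⁻ jr∈)

    jr≢jl : jr ≢ jl
    jr≢jl = proj₂ (∈-remove⁻ jr∈)

    ordinal-pivot-shape : ∀ {B'} → Shape B' O jl → Shape B' O' j*
    ordinal-pivot-shape s = record
      { shape⁻ = λ j∈B' →
          Data.Sum.map₂ (λ (j∈O , j≢jl) → ∈O'⁺ j∈O j≢jl , λ { refl → j*∉O j∈O }) (shape⁻ j∈B')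
      ; shape⁺ = λ { (inj₁ j≡0) → shape⁺ (inj₁ j≡0)
                   ; (inj₂ (j∈O' , j≢j*)) → shape⁺ (inj₂ ([ ⊥-elim ∘ j≢j* , id ]′ (∈O'⁻ j∈O'))) }
      }
      where open Shape s

    zero∉O' : zero ∉ˢ O → j* ≢ zero → zero ∉ˢ O'
    zero∉O' 0∉O j*≢0 0∈O' = [ j*≢0 ∘ sym , 0∉O ∘ proj₁ ]′ (∈O'⁻ 0∈O')

  cardinal-pivot-shape : ∀ {B O jt jl′ B' jl} → ScarfInvariant B O → jt ∈ˢ O → jt ∉ˢ B →
                         CardPivot B jt jl′ B' → jl ∈ˢ O → jl ∉ˢ B' → Shape B' O jl
  cardinal-pivot-shape {B} {O} {jt} {jl′} {B'} {jl} I jt∈O jt∉B (_ , _ , _ , _ , _ , _ , _ , B'≡) jl∈O jl∉B' =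
    record { shape⁻ = shape'⁻ ; shape⁺ = shape'⁺ }
    where
      open ScarfInvariant I
      open Shape shape

      ∈B'⁻ : ∀ {j} → j ∈ˢ B' → j ≡ jt ⊎ (j ∈ˢ B × j ≢ jl′)
      ∈B'⁻ {j} p = ∈-exchange⁻ (subst (j ∈ˢ_) B'≡ p)
      ∈B'⁺ : ∀ {j} → j ∈ˢ B → j ≢ jl′ → j ∈ˢ B'
      ∈B'⁺ {j} p j≢jl′ = subst (j ∈ˢ_) (sym B'≡) (∈-exchange⁺ p j≢jl′)
      jt∈B' : jt ∈ˢ B'
      jt∈B' = subst (jt ∈ˢ_) (sym B'≡) ∈-exchange-new

      jt≡outsider : jt ≡ outsider
      jt≡outsider with jt Finₚ.≟ outsider
      ... | yes e = e
      ... | no jt≢t = contradiction (shape⁺ (inj₂ (jt∈O , jt≢t))) jt∉B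
      jl≢jt : jl ≢ jt
      jl≢jt refl = jl∉B' jt∈B'
      jl∈B : jl ∈ˢ B
      jl∈B = shape⁺ (inj₂ (jl∈O , λ jl≡t → jl≢jt (trans jl≡t (sym jt≡outsider))))
      jl≡jl′ : jl ≡ jl′
      jl≡jl′ with jl Finₚ.≟ jl′
      ... | yes e = e
      ... | no jl≢jl′ = contradiction (∈B'⁺ jl∈B jl≢jl′) jl∉B'

      shape'⁻ : ∀ {j} → j ∈ˢ B' → j ≡ zero ⊎ (j ∈ˢ O × j ≢ jl)
      shape'⁻ j∈B' with ∈B'⁻ j∈B'
      ... | inj₁ refl = inj₂ (jt∈O , jl≢jt ∘ sym)
      ... | inj₂ (j∈B , j≢jl′) =
        Data.Sum.map₂ (λ (j∈O , _) → j∈O , j≢jl′ ∘ (λ e → trans e jl≡jl′)) (shape⁻ j∈B)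

      shape'⁺ : ∀ {j} → j ≡ zero ⊎ (j ∈ˢ O × j ≢ jl) → j ∈ˢ B'
      shape'⁺ (inj₁ refl) =
        ∈B'⁺ (shape⁺ (inj₁ refl)) λ 0≡jl′ → zero∉O (subst (_∈ˢ O) (trans jl≡jl′ (sym 0≡jl′)) jl∈O)
      shape'⁺ {j} (inj₂ (j∈O , j≢jl)) with j Finₚ.≟ outsider
      ... | yes refl = subst (_∈ˢ B') jt≡outsider jt∈B'
      ... | no j≢t = ∈B'⁺ (shape⁺ (inj₂ (j∈O , j≢t))) (j≢jl ∘ (λ e → trans e (sym jl≡jl′)))

module OrdinalPivot {n} (H : HPS n) {C : Fin n → Fin (HPS.m H) → ℕ} (VC : HPS.ValidCost H C)
                    {M : ℕ} (C<M : ∀ v k → C v k <ℕ M) where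
  open Scarf H C M
  open ScarfPairs H C M
  open AugmentedCosts H VC C<M

  module _ {O} (ob : OrdinalBasis O) {jl il jr ir j* O'} (op : OrdPivot O jl il jr ir j* O') where
    open OrdinalBasis ob
    open OrdPivot op

    private
      O⁻ : Cols
      O⁻ = remove O jl

      cheapest⁻ : Row → Col
      cheapest⁻ r = proj₁ (utility-exists O⁻ r (jr , jr∈))

      cheapest⁻∈ : ∀ r → cheapest⁻ r ∈ˢ O⁻
      cheapest⁻∈ r = proj₁ (proj₂ (utility-exists O⁻ r (jr , jr∈)))

      cheapest⁻-utility : ∀ r → IsUtility O⁻ r (C' r (cheapest⁻ r))
      cheapest⁻-utility r = proj₂ (proj₂ (utility-exists O⁻ r (jr , jr∈)))

      j*-beats-O⁻ : ∀ {r} → r ≢ ir → C' r (cheapest⁻ r) <ℕ C' r j*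
      j*-beats-O⁻ {r} r≢ir = j*-cand r r≢ir _ (cheapest⁻-utility r)

    j*-cheapest-for-ir : ∀ j → j ∈ˢ O → C' ir j* ≤ℕ C' ir j
    j*-cheapest-for-ir with outside-dominated j* j*∉O
    ... | r , dom with r Finₚ.≟ ir
    ...   | yes refl = dom
    ...   | no r≢ir = contradiction (dom (cheapest⁻ r) (proj₁ (∈-remove⁻ (cheapest⁻∈ r))))
                                    (ℕₚ.<⇒≱ (j*-beats-O⁻ r≢ir))

    pivot-utility-ir : IsUtility O' ir (C' ir j*)
    pivot-utility-ir = (j* , j*∈O' op , refl) ,
      λ j j∈O' → [ (λ { refl → ℕₚ.≤-refl }) , j*-cheapest-for-ir j ∘ proj₁ ]′ (∈O'⁻ op j∈O')

    private
      pivot-utility-other : ∀ {r} → r ≢ ir → IsUtility O' r (C' r (cheapest⁻ r))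
      pivot-utility-other {r} r≢ir = (cheapest⁻ r , uncurry (∈O'⁺ op) (∈-remove⁻ (cheapest⁻∈ r)) , refl) ,
        λ j j∈O' → [ (λ { refl → ℕₚ.<⇒≤ (j*-beats-O⁻ r≢ir) })
                   , proj₂ (cheapest⁻-utility r) j ∘ uncurry ∈-remove⁺ ]′ (∈O'⁻ op j∈O')

      il≢ir : il ≢ ir
      il≢ir refl = jr≢jl op (disliked-column-unique il ir-jr il-jl)

      pivot-outside-dominated : ∀ k → k ∉ˢ O' → ∃[ r ] (∀ j → j ∈ˢ O' → C' r k ≤ℕ C' r j)
      pivot-outside-dominated k k∉O' with k Finₚ.≟ jl
      ... | yes refl = il , below-utility il (pivot-utility-other il≢ir)
                              (proj₂ (proj₂ il-jl) _ (proj₁ (∈-remove⁻ (cheapest⁻∈ il))))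
      ... | no k≢jl with Finₚ.any?
                           (λ r → ¬? (r Finₚ.≟ ir) ×-dec (C' r k Data.Nat.≤? C' r (cheapest⁻ r)))
      ...   | yes (r , r≢ir , k≤) = r , below-utility r (pivot-utility-other r≢ir) k≤
      ...   | no none = ir , below-utility ir pivot-utility-ir (j*-max k k∉O k-beats-O⁻)
        where
          k∉O : k ∉ˢ O
          k∉O k∈O = k∉O' (∈O'⁺ op k∈O k≢jl)
          k-beats-O⁻ : ∀ r → r ≢ ir → ∀ u → IsUtility O⁻ r u → u <ℕ C' r k
          k-beats-O⁻ r r≢ir u U = subst (_<ℕ C' r k) (utility-unique r (cheapest⁻-utility r) U)
                                    (ℕₚ.≰⇒> λ k≤ → none (r , r≢ir , k≤))

      cheapest⁻-disliked : ∀ {r} → r ≢ il → Disliked O r (cheapest⁻ r)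
      cheapest⁻-disliked {r} r≢il with utility-exists O r (jr , jr∈O op)
      ... | jm , jm∈O , U =
        subst (Disliked O r) (C'-injective r (utility-unique r U⁻ (cheapest⁻-utility r))) (jm∈O , U)
        where
          jm≢jl : jm ≢ jl
          jm≢jl refl = r≢il (disliker-unique (jm∈O , U) il-jl)
          U⁻ : IsUtility O⁻ r (C' r jm)
          U⁻ = (jm , ∈-remove⁺ jm∈O jm≢jl , refl) , λ j j∈O⁻ → proj₂ U j (proj₁ (∈-remove⁻ j∈O⁻))

      data DislikedAfterPivot (r : Row) (j : Col) : Set where
        entering  : r ≡ ir → j ≡ j* → DislikedAfterPivot r j
        reference : r ≡ il → j ≡ jr → DislikedAfterPivot r j
        unchanged : r ≢ ir → Disliked O r j → DislikedAfterPivot r j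

      classify : ∀ {r j} → Disliked O' r j → DislikedAfterPivot r j
      classify {r} {j} (_ , U) with r Finₚ.≟ ir
      ... | yes refl = entering refl (C'-injective ir (utility-unique ir U pivot-utility-ir))
      ... | no r≢ir with C'-injective r (utility-unique r U (pivot-utility-other r≢ir)) | r Finₚ.≟ il
      ...   | refl | yes refl = reference refl (C'-injective il (utility-unique il (cheapest⁻-utility il) jr-utility))
        where
          jr-utility : IsUtility O⁻ il (C' il jr)
          jr-utility = (jr , jr∈ , refl) , jr-min
      ...   | refl | no r≢il  = unchanged r≢ir (cheapest⁻-disliked r≢il)

      pivot-disliker-unique : ∀ {r r' j} → Disliked O' r j → Disliked O' r' j → r ≡ r'
      pivot-disliker-unique {r} {r'} {j} d d' = both (classify d) (classify d')
        where
          both : DislikedAfterPivot r j → DislikedAfterPivot r' j → r ≡ r'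
          both (entering e _)       (entering e' _)     = trans e (sym e')
          both (entering _ refl)    (reference _ e)     = contradiction (subst (_∈ˢ O) (sym e) (jr∈O op)) j*∉O
          both (entering _ refl)    (unchanged _ d)     = contradiction (proj₁ d) j*∉O
          both (reference _ e)      (entering _ refl)   = contradiction (subst (_∈ˢ O) (sym e) (jr∈O op)) j*∉O
          both (reference e _)      (reference e' _)    = trans e (sym e')
          both (reference _ refl)   (unchanged r'≢ir d) = contradiction (disliker-unique d ir-jr) r'≢ir
          both (unchanged _ d)      (entering _ refl)   = contradiction (proj₁ d) j*∉O
          both (unchanged r≢ir d)   (reference _ refl)  = contradiction (disliker-unique d ir-jr) r≢ir
          both (unchanged _ d)      (unchanged _ d')    = disliker-unique d d'

    pivot-ordinal-basis : OrdinalBasis O'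
    pivot-ordinal-basis = record
      { outside-dominated = pivot-outside-dominated ; disliker-unique = pivot-disliker-unique }

module Reachability {n} (H : HPS n) (BO : HPS.BlockOrdered H)
                    {C : Fin n → Fin (HPS.m H) → ℕ} (VC : HPS.ValidCost H C)
                    {M : ℕ} (C<M : ∀ v k → C v k <ℕ M) where
  open HPS H
  open Scarf H C M
  open ScarfPairs H C M
  open BlockFacts H BO VC
  open AugmentedCosts H VC C<M
  open OrdinalPivot H VC C<M

  private
    inB₀ inO₀ : Col → Data.Bool.Bool
    inB₀ j = toℕ j Data.Nat.≤ᵇ n
    inO₀ j = (1 Data.Nat.≤ᵇ toℕ j) Data.Bool.∧ (toℕ j Data.Nat.≤ᵇ suc n)

  ∈B₀⁻ : ∀ {j} → j ∈ˢ B₀ → toℕ j ≤ℕ n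
  ∈B₀⁻ {j} p = ℕₚ.≤ᵇ⇒≤ (toℕ j) n (Equivalence.from T-≡ (∈-tabulate⁻ inB₀ p))

  ∈B₀⁺ : ∀ {j} → toℕ j ≤ℕ n → j ∈ˢ B₀
  ∈B₀⁺ j≤n = ∈-tabulate⁺ inB₀ (Equivalence.to T-≡ (ℕₚ.≤⇒≤ᵇ j≤n))

  zero∉O₀ : zero ∉ˢ O₀
  zero∉O₀ p with ∈-tabulate⁻ inO₀ p
  ... | ()

  ∈O₀⁻ : ∀ {k} → suc k ∈ˢ O₀ → toℕ k ≤ℕ n
  ∈O₀⁻ {k} p = s≤s⁻¹ (ℕₚ.≤ᵇ⇒≤ (suc (toℕ k)) (suc n) (Equivalence.from T-≡ (∈-tabulate⁻ inO₀ p)))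

  ∈O₀⁺ : ∀ {k} → toℕ k ≤ℕ n → suc k ∈ˢ O₀
  ∈O₀⁺ k≤n = ∈-tabulate⁺ inO₀ (Equivalence.to T-≡ (ℕₚ.≤⇒≤ᵇ (s≤s k≤n)))

  module Initial (n<m : n <ℕ m) where

    lastColumn : Fin m
    lastColumn = fromℕ< n<m

    toℕ-lastColumn : toℕ lastColumn ≡ n
    toℕ-lastColumn = Finₚ.toℕ-fromℕ< n<m

    disliked₀ : Row → Col
    disliked₀ zero    = suc lastColumn
    disliked₀ (suc v) = suc (singletonColumn v)

    rowIndex₀ : Row → ℕ
    rowIndex₀ zero    = suc n
    rowIndex₀ (suc v) = suc (toℕ v)

    toℕ-disliked₀ : ∀ r → toℕ (disliked₀ r) ≡ rowIndex₀ r
    toℕ-disliked₀ zero    = cong suc toℕ-lastColumn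
    toℕ-disliked₀ (suc v) = cong suc (toℕ-singletonColumn v)

    rowIndex₀-injective : ∀ {r r'} → rowIndex₀ r ≡ rowIndex₀ r' → r ≡ r'
    rowIndex₀-injective {zero}  {zero}   _ = refl
    rowIndex₀-injective {zero}  {suc v'} e = contradiction (sym (ℕₚ.suc-injective e)) (ℕₚ.<⇒≢ (Finₚ.toℕ<n v'))
    rowIndex₀-injective {suc v} {zero}   e = contradiction (ℕₚ.suc-injective e) (ℕₚ.<⇒≢ (Finₚ.toℕ<n v))
    rowIndex₀-injective {suc v} {suc v'} e = cong suc (Finₚ.toℕ-injective (ℕₚ.suc-injective e))

    disliked₀-injective : ∀ {r r'} → disliked₀ r ≡ disliked₀ r' → r ≡ r'
    disliked₀-injective {r} {r'} e =
      rowIndex₀-injective (trans (sym (toℕ-disliked₀ r)) (trans (cong toℕ e) (toℕ-disliked₀ r')))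

    disliked₀-correct : ∀ {r j} → Disliked O₀ r j → j ≡ disliked₀ r
    disliked₀-correct {j = zero} (0∈O₀ , _) = contradiction 0∈O₀ zero∉O₀
    disliked₀-correct {zero} {suc k} (k∈O₀ , _ , min) =
      cong suc (Finₚ.toℕ-injective (ℕₚ.≤-antisym (subst (toℕ k ≤ℕ_) (sym toℕ-lastColumn) (∈O₀⁻ k∈O₀))
        (row₀-antitone (min (suc lastColumn) (∈O₀⁺ (ℕₚ.≤-reflexive toℕ-lastColumn))))))
    disliked₀-correct {suc v} {suc k} (_ , _ , min) =
      singleton-cheapest (edge-singletonColumn v) (suc k) (λ ()) (min (suc (singletonColumn v)) singleton∈O₀)
      where
        singleton∈O₀ : suc (singletonColumn v) ∈ˢ O₀
        singleton∈O₀ = ∈O₀⁺ (subst (_≤ℕ n) (sym (toℕ-singletonColumn v)) (ℕₚ.<⇒≤ (Finₚ.toℕ<n v)))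

    outside-dominated₀ : ∀ k → k ∉ˢ O₀ → ∃[ r ] (∀ j → j ∈ˢ O₀ → C' r k ≤ℕ C' r j)
    outside-dominated₀ zero    _      = zero , λ _ _ → z≤n
    outside-dominated₀ (suc k) k∉O₀ = zero , dominated
      where
        dominated : ∀ j → j ∈ˢ O₀ → C' zero (suc k) ≤ℕ C' zero j
        dominated zero     0∈O₀  = contradiction 0∈O₀ zero∉O₀
        dominated (suc k') k'∈O₀ = ℕₚ.<⇒≤ (row₀-strictly-antitone
          (ℕₚ.≤-<-trans (∈O₀⁻ k'∈O₀) (ℕₚ.≰⇒> (k∉O₀ ∘ ∈O₀⁺))))

    shape₀ : Shape B₀ O₀ (suc lastColumn)
    shape₀ = record { shape⁻ = shape⁻ ; shape⁺ = shape⁺ }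
      where
        ≢last : ∀ {k} → toℕ k <ℕ n → suc k ≢ suc lastColumn
        ≢last k<n e = ℕₚ.<⇒≢ k<n (trans (cong toℕ (Finₚ.suc-injective e)) toℕ-lastColumn)
        shape⁻ : ∀ {j} → j ∈ˢ B₀ → j ≡ zero ⊎ (j ∈ˢ O₀ × j ≢ suc lastColumn)
        shape⁻ {zero}  _   = inj₁ refl
        shape⁻ {suc k} k∈B₀ = inj₂ (∈O₀⁺ (ℕₚ.<⇒≤ (∈B₀⁻ k∈B₀)) , ≢last (∈B₀⁻ k∈B₀))
        shape⁺ : ∀ {j} → j ≡ zero ⊎ (j ∈ˢ O₀ × j ≢ suc lastColumn) → j ∈ˢ B₀
        shape⁺ (inj₁ refl) = ∈B₀⁺ z≤n
        shape⁺ {zero}  (inj₂ (0∈O₀ , _)) = contradiction 0∈O₀ zero∉O₀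
        shape⁺ {suc k} (inj₂ (k∈O₀ , k≢last)) = ∈B₀⁺ (ℕₚ.≤∧≢⇒< (∈O₀⁻ k∈O₀)
          λ k≡n → k≢last (cong suc (Finₚ.toℕ-injective (trans k≡n (sym toℕ-lastColumn)))))

    invariant₀ : ScarfInvariant B₀ O₀
    invariant₀ = record
      { ordinal    = record
        { outside-dominated = outside-dominated₀
        ; disliker-unique   = λ d d' →
            disliked₀-injective (trans (sym (disliked₀-correct d)) (disliked₀-correct d')) }
      ; zero∉O     = zero∉O₀
      ; outsider   = suc lastColumn
      ; outsider∈O = ∈O₀⁺ (ℕₚ.≤-reflexive toℕ-lastColumn)
      ; shape      = shape₀ }

  invariant-step : ∀ {B O B' O'} → ScarfInvariant B O → Iteration (B , O) (B' , O') → B' ≢ O' →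
                   ScarfInvariant B' O'
  invariant-step {B' = B'} {O'} I (_ , _ , jt∈O , jt∉B , _ , cp , jl , jl∈O , jl∉B' , _ , _ , _ , j* , op) B'≢O' =
    step (j* Finₚ.≟ zero)
    where
      open ScarfInvariant I
      shape' : Shape B' O' j*
      shape' = ordinal-pivot-shape op (cardinal-pivot-shape I jt∈O jt∉B cp jl∈O jl∉B')
      step : Dec (j* ≡ zero) → ScarfInvariant B' O'
      step (yes refl) = contradiction (shape-zero⇒≡ shape' (j*∈O' op)) B'≢O'
      step (no j*≢0)  = record
        { ordinal = pivot-ordinal-basis ordinal op ; zero∉O = zero∉O' op zero∉O j*≢0
        ; outsider = j* ; outsider∈O = j*∈O' op ; shape = shape' }

  InvariantOnScarfPairs : State → Set
  InvariantOnScarfPairs (B , O) = B ≢ O → ScarfInvariant B O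

  invariant-along : ∀ {s s'} → Star Iteration s s' → InvariantOnScarfPairs s → InvariantOnScarfPairs s'
  invariant-along ε                  inv = inv
  invariant-along (iteration ◅ rest) inv =
    invariant-along rest (invariant-step (inv (proj₁ iteration)) iteration)

  reachable-invariant : ∀ {B O} → n <ℕ m → Reachable (B , O) → B ≢ O → ScarfInvariant B O
  reachable-invariant n<m reach = invariant-along reach (λ _ → Initial.invariant₀ n<m)

module SeparatorStep {n} (H : HPS n) (BO : HPS.BlockOrdered H)
                     {C : Fin n → Fin (HPS.m H) → ℕ} (VC : HPS.ValidCost H C)
                     {M : ℕ} (C<M : ∀ v k → C v k <ℕ M) where
  open HPS H
  open Scarf H C M
  open ScarfPairs H C M
  open CostFacts H VC
  open BlockFacts H BO VC
  open AugmentedCosts H VC C<M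
  open OrdinalPivot H VC C<M

  later-column-in-later-block : ∀ {i k} → InS i k → ∀ j → j ≢ zero →
    C' zero j <ℕ C' zero (suc k) → C i k <ℕ C' (suc i) j → ∃[ i' ] (InSᶜ i' j × i < i')
  later-column-in-later-block k∈Sᵢ zero j≢0 _ _ = contradiction refl j≢0
  later-column-in-later-block {i} {k} k∈Sᵢ (suc k*) _ right costlier with largest (edge k*) (edge-nonempty k*)
  ... | i' , i'-max = i' , (not-singleton , i'-max) , i<i'
    where
      k<k* : k < k*
      k<k* = ℕₚ.≤∧≢⇒< (row₀-antitone (ℕₚ.<⇒≤ right))
               λ e → ℕₚ.<-irrefl (cong (C' zero ∘ suc) (sym (Finₚ.toℕ-injective e))) right
      not-singleton : edge k* ≢ ⁅ i' ⁆
      not-singleton e = ℕₚ.<-irrefl refl (ℕₚ.<-trans (subst (_<ℕ n) (sym (singleton-index e)) (Finₚ.toℕ<n i'))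
                                                      (ℕₚ.≤-<-trans (S-column-index k∈Sᵢ) k<k*))
      i<i' : i < i'
      i<i' = [ (λ i<i' → i<i') , (λ cheaper → contradiction costlier (ℕₚ.<-asym cheaper)) ]′
               (later-column k∈Sᵢ k<k* i'-max)

  module Step {B O B' O' jl il jr ir j* i k}
              (I : ScarfInvariant B O) (B'-shape : Shape B' O jl) (op : OrdPivot O jl il jr ir j* O')
              (k∈Sᵢ : InS i k) (0-k : Disliked O zero (suc k)) (i-jl : Disliked O (suc i) jl) where
    open ScarfInvariant I
    open OrdinalBasis ordinal
    open OrdPivot op

    il≡i : il ≡ suc i
    il≡i = disliker-unique il-jl i-jl

    jl≢zero : jl ≢ zero
    jl≢zero e = zero∉O (subst (_∈ˢ O) e (proj₁ i-jl))

    jl≢k : jl ≢ suc k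
    jl≢k e with disliker-unique {zero} {suc i} 0-k (subst (Disliked O (suc i)) e i-jl)
    ... | ()

    left-of-separator-column : ∀ {k'} → suc k' ∈ˢ O → k' ≢ k → toℕ k' <ℕ toℕ k
    left-of-separator-column k'∈O k'≢k =
      ℕₚ.≤∧≢⇒< (s≤s⁻¹ (row₀-disliked-largest 0-k k'∈O)) (k'≢k ∘ Finₚ.toℕ-injective)

    separator-column-cost< : ∀ {k'} → suc k' ∈ˢ O → suc k' ≢ jl → k' ≢ k → C i k <ℕ C i k'
    separator-column-cost< {k'} k'∈O k'≢jl k'≢k with i ∈? edge k' | toℕ k' Data.Nat.<? n
    ... | no  i∉e' | _       = incident<nonincident (proj₁ (proj₂ k∈Sᵢ)) i∉e'
    ... | yes i∈e' | no k'≮n =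
      earlier-column-costlier k∈Sᵢ (ℕₚ.≮⇒≥ k'≮n) (left-of-separator-column k'∈O k'≢k) i∈e'
    ... | yes i∈e' | yes k'<n = contradiction jl≡k' (k'≢jl ∘ sym)
      where
        jl≡k' : jl ≡ suc k'
        jl≡k' = singleton-cheapest (low-column-singleton k'<n i∈e') jl jl≢zero (proj₂ (proj₂ i-jl) (suc k') k'∈O)

    cheapest-is-separator-column : ∀ j → j ∈ˢ O → j ≢ jl → C' (suc i) j ≤ℕ C i k → j ≡ suc k
    cheapest-is-separator-column zero     0∈O  _      _  = contradiction 0∈O zero∉O
    cheapest-is-separator-column (suc k') k'∈O k'≢jl c≤ with k' Finₚ.≟ k
    ... | yes k'≡k = cong suc k'≡k
    ... | no  k'≢k = contradiction c≤ (ℕₚ.<⇒≱ (separator-column-cost< k'∈O k'≢jl k'≢k))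

    separator-column∈O⁻ : suc k ∈ˢ remove O jl
    separator-column∈O⁻ = ∈-remove⁺ (proj₁ 0-k) (jl≢k ∘ sym)

    reference≡separator-column : jr ≡ suc k
    reference≡separator-column = cheapest-is-separator-column jr (jr∈O op) (jr≢jl op)
      (subst (λ r → C' r jr ≤ℕ C' r (suc k)) il≡i (jr-min (suc k) separator-column∈O⁻))

    reference-disliked-by-zero : Disliked O zero jr
    reference-disliked-by-zero = subst (Disliked O zero) (sym reference≡separator-column) 0-k

    reference-largest : ∀ j → j ∈ˢ O → j ≤ jr
    reference-largest j j∈O = subst (j ≤_) (sym reference≡separator-column) (row₀-disliked-largest 0-k j∈O)

    ir≡zero : ir ≡ zero
    ir≡zero = disliker-unique ir-jr reference-disliked-by-zero

    entering-disliked-by-zero : Disliked O' zero j*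
    entering-disliked-by-zero = subst (λ r → Disliked O' r j*) ir≡zero (j*∈O' op , pivot-utility-ir ordinal op)

    entering≢zero : B' ≢ O' → j* ≢ zero
    entering≢zero B'≢O' e = B'≢O' (shape-zero⇒≡ (subst (Shape B' O') e (ordinal-pivot-shape op B'-shape))
                                                 (subst (_∈ˢ O') e (j*∈O' op)))

    entering-right-of-separator : C' zero j* <ℕ C' zero (suc k)
    entering-right-of-separator = ℕₚ.≤∧≢⇒<
      (subst (λ r → C' r j* ≤ℕ C' r (suc k)) ir≡zero (j*-cheapest-for-ir ordinal op (suc k) (proj₁ 0-k)))
      (λ e → j*∉O (subst (_∈ˢ O) (sym (C'-injective zero e)) (proj₁ 0-k)))

    entering-costlier : C i k <ℕ C' (suc i) j*
    entering-costlier = j*-cand (suc i) suc-i≢ir (C i k) separator-utility⁻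
      where
        suc-i≢ir : suc i ≢ ir
        suc-i≢ir e with trans e ir≡zero
        ... | ()
        separator-utility⁻ : IsUtility (remove O jl) (suc i) (C i k)
        separator-utility⁻ = (suc k , separator-column∈O⁻ , refl) ,
          subst₂ (λ r c → ∀ j → j ∈ˢ remove O jl → C' r c ≤ℕ C' r j) il≡i reference≡separator-column jr-min

    separator-increases : B' ≢ O' → ∃[ i' ] (Separator B' O' i' × i < i')
    separator-increases B'≢O'
      with later-column-in-later-block k∈Sᵢ j* (entering≢zero B'≢O') entering-right-of-separator entering-costlier
    ... | i' , j*∈Sᵢ' , i<i' = i' , (B'≢O' , j* , entering-disliked-by-zero , j*∈Sᵢ') , i<i'

lemma3p5 : ∀ {n} (H : HPS n) → HPS.BlockOrdered H →
    (C : Fin n → Fin (HPS.m H) → ℕ) → HPS.ValidCost H C →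
    (M : ℕ) → (∀ v k → C v k <ℕ M) →
    ∀ B O → Scarf.Reachable H C M (B , O) → B ≢ O →
    ∀ jt jl′ B' → jt ∈ˢ O → jt ∉ˢ B → Scarf.CardPivot H C M B jt jl′ B' →
    ∀ jl → jl ∈ˢ O → jl ∉ˢ B' →
    ∀ il jr ir j* O' → Scarf.OrdPivot H C M O jl il jr ir j* O' →
    ∀ i → Scarf.Separator H C M B O i → Scarf.Disliked H C M O (Data.Fin.suc i) jl →
    (Scarf.Disliked H C M O zero jr × jr ∈ˢ O × (∀ j → j ∈ˢ O → j ≤ jr)) ×
    (Scarf.Disliked H C M O zero jr × Scarf.Disliked H C M O' zero j*) ×
    (B' ≢ O' → ∃[ i' ] (Scarf.Separator H C M B' O' i' × i < i'))
lemma3p5 H BO C VC M C<M B O reach B≢O jt jl′ B' jt∈O jt∉B cp jl jl∈O jl∉B' il jr ir j* O' op i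
         (_ , zero , _ , ()) i-jl
lemma3p5 H BO C VC M C<M B O reach B≢O jt jl′ B' jt∈O jt∉B cp jl jl∈O jl∉B' il jr ir j* O' op i
         (_ , suc k , 0-k , k∈Sᵢ) i-jl =
  (reference-disliked-by-zero , jr∈O op , reference-largest) ,
  (reference-disliked-by-zero , entering-disliked-by-zero) ,
  separator-increases
  where
    open ScarfPairs H C M
    open Reachability H BO VC C<M using (reachable-invariant)
    open BlockFacts H BO VC using (S-column-index)

    I : ScarfInvariant B O
    I = reachable-invariant (ℕₚ.≤-<-trans (S-column-index k∈Sᵢ) (Finₚ.toℕ<n k)) reach B≢O

    open SeparatorStep.Step H BO VC C<M I (cardinal-pivot-shape I jt∈O jt∉B cp jl∈O jl∉B') op k∈Sᵢ 0-k i-jl
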